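{- Let $\mathsf{ML}$ be any of the fourteen minimal modal logics $\mathsf{MM},\mathsf{MMP},\mathsf{MMN},\mathsf{MMNP},\mathsf{MMC},\mathsf{MK},\mathsf{MMD},\mathsf{MMT},\mathsf{MMND},\mathsf{MMNT},\mathsf{MMCD},\mathsf{MMCT},\mathsf{MKD},\mathsf{MKT}$. For every formula $A$ of $\mathcal L$, if $A$ is derivable in $\mathsf{ML}$, then $A$ is valid in every minimal neighbourhood model for $\mathsf{ML}$.
   Context: $\mathcal L$ is the language $A ::= p \mid \bot \mid A\wedge A \mid A\vee A \mid A\to A \mid \Box A \mid \Diamond A$ over a countable set $\mathrm{Atm}$; $\top:=\bot\to\bot$. $\mathsf{MPL}$ is axiomatised by $A\wedge B\to A$, $A\wedge B\to B$, $A\to A\vee B$, $B\to A\vee B$, $(A\to B)\to((A\to C)\to(A\to B\wedge C))$, $(A\to C)\to((B\to C)\to(A\vee B\to C))$, $(A\to(B\to C))\to((A\to B)\to(A\to C))$, $A\to(B\to A)$, and modus ponens. Modal principles: Mon$\Box$: rule $A\to B/\Box A\to\Box B$; Mon$\Diamond$: rule $A\to B/\Diamond A\to\Diamond B$; N$\Box$: $\Box\top$; C$\Box$: $\Box A\wedge\Box B\to\Box(A\wedge B)$; K$\Diamond$: $\Box(A\to B)\to(\Diamond A\to\Diamond B)$; P$\Diamond$: $\Diamond\top$; D: $\Box A\to\Diamond A$; T$\Box$: $\Box A\to A$; T$\Diamond$: $A\to\Diamond A$. Logics (all over $\mathcal L$): $\mathsf{MM}=\mathsf{MPL}$+Mon$\Box$+Mon$\Diamond$;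 $\mathsf{MMP}=\mathsf{MM}$+P$\Diamond$; $\mathsf{MMN}=\mathsf{MM}$+N$\Box$; $\mathsf{MMNP}=\mathsf{MMN}$+P$\Diamond$; $\mathsf{MMC}=\mathsf{MM}$+C$\Box$+K$\Diamond$; $\mathsf{MK}=\mathsf{MMC}$+N$\Box$; $\mathsf{MMD}=\mathsf{MM}$+D+P$\Diamond$; $\mathsf{MMT}=\mathsf{MM}$+T$\Box$+T$\Diamond$; $\mathsf{MMND}=\mathsf{MMN}$+D; $\mathsf{MMNT}=\mathsf{MMN}$+T$\Box$+T$\Diamond$; $\mathsf{MMCD}=\mathsf{MMC}$+D+P$\Diamond$; $\mathsf{MMCT}=\mathsf{MMC}$+T$\Box$+T$\Diamond$; $\mathsf{MKD}=\mathsf{MK}$+D; $\mathsf{MKT}=\mathsf{MK}$+T$\Box$+T$\Diamond$. A minimal neighbourhood model is $\langle W,\le,F,N,V\rangle$ with $W\ne\emptyset$, $\le$ reflexive transitive, $F$ and each $V(p)$ upward closed under $\le$, $N:W\to\mathcal P(\mathcal P(W))$. Forcing: $w\Vdash p$ iff $w\in V(p)$; $w\Vdash\bot$ iff $w\in F$; $\wedge,\vee$ pointwise; $w\Vdash B\to C$ iff for all $v\ge w$, $v\Vdash B$ implies $v\Vdash C$; $w\Vdash\Box B$ iff for all $v\ge w$ some $\alpha\in N(v)$ has all its elements forcing $B$; $w\Vdash\Diamond B$ iff for all $v\ge w$, every $\alpha\in N(v)$ contains an element forcing $B$. Conditions on $N$ (for all $w$ and $\alpha,\beta$): (C) $\alpha,\beta\in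 N(w)\Rightarrow\alpha\cap\beta\in N(w)$; (N) $N(w)\ne\emptyset$; (D) $\alpha,\beta\in N(w)\Rightarrow\alpha\cap\beta\ne\emptyset$; (P) $\emptyset\notin N(w)$; (T) $\alpha\in N(w)\Rightarrow w\in\alpha$. A model for $\mathsf{ML}$ satisfies: $\mathsf{MM}$: none; $\mathsf{MMP}$: P; $\mathsf{MMN}$: N; $\mathsf{MMNP}$: N,P; $\mathsf{MMC}$: C; $\mathsf{MK}$: C,N; $\mathsf{MMD}$: D; $\mathsf{MMT}$: T; $\mathsf{MMND}$: N,D; $\mathsf{MMNT}$: N,T; $\mathsf{MMCD}$: C,D; $\mathsf{MMCT}$: C,T; $\mathsf{MKD}$: C,N,D; $\mathsf{MKT}$: C,N,T. Valid = forced at all worlds. -}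

module Defs where

open import Data.Nat using (ℕ)
open import Data.Product using (Σ; ∃; _×_; _,_)
open import Data.Sum using (_⊎_)
open import Data.Empty using (⊥)
open import Data.Unit using (⊤)
open import Level using (Lift)

Atm : Set
Atm = ℕ

infixr 5 _⇒_
infixr 6 _∨′_
infixr 7 _∧′_

data Fm : Set where
  atom : Atm → Fm
  ⊥′   : Fm
  _∧′_ : Fm → Fm → Fm
  _∨′_ : Fm → Fm → Fm
  _⇒_  : Fm → Fm → Fm
  □    : Fm → Fm
  ◇    : Fm → Fm

⊤′ : Fm
⊤′ = ⊥′ ⇒ ⊥′

data Logic : Set where
  MM MMP MMN MMNP MMC MK MMD MMT MMND MMNT MMCD MMCT MKD MKT : Logic

hasN□ : Logic → Set
hasN□ MMN  = ⊤
hasN□ MMNP = ⊤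
hasN□ MK   = ⊤
hasN□ MMND = ⊤
hasN□ MMNT = ⊤
hasN□ MKD  = ⊤
hasN□ MKT  = ⊤
hasN□ _    = ⊥

hasP◇ : Logic → Set
hasP◇ MMP  = ⊤
hasP◇ MMNP = ⊤
hasP◇ MMD  = ⊤
hasP◇ MMCD = ⊤
hasP◇ _    = ⊥

hasC : Logic → Set
hasC MMC  = ⊤
hasC MK   = ⊤
hasC MMCD = ⊤
hasC MMCT = ⊤
hasC MKD  = ⊤
hasC MKT  = ⊤
hasC _    = ⊥

hasD : Logic → Set
hasD MMD  = ⊤
hasD MMND = ⊤
hasD MMCD = ⊤
hasD MKD  = ⊤
hasD _    = ⊥

hasT : Logic → Set
hasT MMT  = ⊤
hasT MMNT = ⊤
hasT MMCT = ⊤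
hasT MKT  = ⊤
hasT _    = ⊥

infix 3 _⊢_

data _⊢_ (L : Logic) : Fm → Set where
  ax∧₁ : ∀ {A B} → L ⊢ A ∧′ B ⇒ A
  ax∧₂ : ∀ {A B} → L ⊢ A ∧′ B ⇒ B
  ax∨₁ : ∀ {A B} → L ⊢ A ⇒ A ∨′ B
  ax∨₂ : ∀ {A B} → L ⊢ B ⇒ A ∨′ B
  ax∧I : ∀ {A B C} → L ⊢ (A ⇒ B) ⇒ ((A ⇒ C) ⇒ (A ⇒ B ∧′ C))
  ax∨E : ∀ {A B C} → L ⊢ (A ⇒ C) ⇒ ((B ⇒ C) ⇒ (A ∨′ B ⇒ C))
  axS  : ∀ {A B C} → L ⊢ (A ⇒ (B ⇒ C)) ⇒ ((A ⇒ B) ⇒ (A ⇒ C))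
  axK  : ∀ {A B} → L ⊢ A ⇒ (B ⇒ A)
  mp   : ∀ {A B} → L ⊢ A ⇒ B → L ⊢ A → L ⊢ B
  mon□ : ∀ {A B} → L ⊢ A ⇒ B → L ⊢ □ A ⇒ □ B
  mon◇ : ∀ {A B} → L ⊢ A ⇒ B → L ⊢ ◇ A ⇒ ◇ B
  axN□ : hasN□ L → L ⊢ □ ⊤′
  axP◇ : hasP◇ L → L ⊢ ◇ ⊤′
  axC□ : ∀ {A B} → hasC L → L ⊢ □ A ∧′ □ B ⇒ □ (A ∧′ B)
  axK◇ : ∀ {A B} → hasC L → L ⊢ □ (A ⇒ B) ⇒ (◇ A ⇒ ◇ B)
  axD  : ∀ {A} → hasD L → L ⊢ □ A ⇒ ◇ A
  axT□ : ∀ {A} → hasT L → L ⊢ □ A ⇒ A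
  axT◇ : ∀ {A} → hasT L → L ⊢ A ⇒ ◇ A

record Model : Set₁ where
  field
    W     : Set
    inhab : W
    _≤_   : W → W → Set
    refl≤ : ∀ {w} → w ≤ w
    trans≤ : ∀ {u v w} → u ≤ v → v ≤ w → u ≤ w
    F     : W → Set
    F-up  : ∀ {w v} → w ≤ v → F w → F v
    V     : Atm → W → Set
    V-up  : ∀ {p w v} → w ≤ v → V p w → V p v
    N     : W → (W → Set) → Set

module _ (M : Model) where
  open Model M

  infix 4 _⊩_
  -- forcing lives in Set₁ since □/◇ quantify over subsets of W
  _⊩_ : W → Fm → Set₁
  w ⊩ atom p  = Lift _ (V p w)
  w ⊩ ⊥′      = Lift _ (F w)
  w ⊩ A ∧′ B  = (w ⊩ A) × (w ⊩ B)
  w ⊩ A ∨′ B  = (w ⊩ A) ⊎ (w ⊩ B)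
  w ⊩ A ⇒ B   = ∀ v → w ≤ v → v ⊩ A → v ⊩ B
  w ⊩ □ A     = ∀ v → w ≤ v → Σ (W → Set) λ α → N v α × (∀ x → α x → x ⊩ A)
  w ⊩ ◇ A     = ∀ v → w ≤ v → ∀ α → N v α → Σ W λ x → α x × (x ⊩ A)

  Valid : Fm → Set₁
  Valid A = ∀ w → w ⊩ A

  CondC : Set₁
  CondC = ∀ w α β → N w α → N w β → N w (λ x → α x × β x)

  CondN : Set₁
  CondN = ∀ w → Σ (W → Set) λ α → N w α

  CondD : Set₁
  CondD = ∀ w α β → N w α → N w β → Σ W λ x → α x × β x

  CondP : Set₁
  CondP = ∀ w α → N w α → Σ W λ x → α x

  CondT : Set₁
  CondT = ∀ w α → N w α → α w

ModelFor : Logic → Model → Set₁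
ModelFor MM   M = Lift _ ⊤
ModelFor MMP  M = CondP M
ModelFor MMN  M = CondN M
ModelFor MMNP M = CondN M × CondP M
ModelFor MMC  M = CondC M
ModelFor MK   M = CondC M × CondN M
ModelFor MMD  M = CondD M
ModelFor MMT  M = CondT M
ModelFor MMND M = CondN M × CondD M
ModelFor MMNT M = CondN M × CondT M
ModelFor MMCD M = CondC M × CondD M
ModelFor MMCT M = CondC M × CondT M
ModelFor MKD  M = CondC M × CondN M × CondD M
ModelFor MKT  M = CondC M × CondN M × CondT M

{-# OPTIONS --safe #-}
-- Forcing is persistent along ≤, which
-- validates the intuitionistic axioms; □ and ◇ quantify over all ≤-successors,
-- so each modal axiom holds at every world as soon as its neighbourhood
-- condition does. The only logics whose axioms are not matched one-to-one by
-- their conditions are MMD and MMCD, where P◇ follows from (D) with α = β.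
module Submission where

open import Defs
open import Data.Product using (_×_; _,_; proj₁; proj₂)
open import Data.Sum using (inj₁; inj₂)
open import Level using (lift)

module Soundness (M : Model) where
  open Model M

  private
    infix 4 _⊨_
    _⊨_ : W → Fm → Set₁
    _⊨_ = _⊩_ M

  ⊩-mono : ∀ A {w v} → w ≤ v → w ⊨ A → v ⊨ A
  ⊩-mono (atom p) w≤v (lift x) = lift (V-up w≤v x)
  ⊩-mono ⊥′       w≤v (lift x) = lift (F-up w≤v x)
  ⊩-mono (A ∧′ B) w≤v (a , b)  = ⊩-mono A w≤v a , ⊩-mono B w≤v b
  ⊩-mono (A ∨′ B) w≤v (inj₁ a) = inj₁ (⊩-mono A w≤v a)
  ⊩-mono (A ∨′ B) w≤v (inj₂ b) = inj₂ (⊩-mono B w≤v b)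
  ⊩-mono (A ⇒ B)  w≤v f = λ u v≤u → f u (trans≤ w≤v v≤u)
  ⊩-mono (□ A)    w≤v f = λ u v≤u → f u (trans≤ w≤v v≤u)
  ⊩-mono (◇ A)    w≤v f = λ u v≤u → f u (trans≤ w≤v v≤u)

  valid-⇒-elim : ∀ {A B} → Valid M (A ⇒ B) → ∀ x → x ⊨ A → x ⊨ B
  valid-⇒-elim A⇒B x = A⇒B x x refl≤

  mp-valid : ∀ {A B} → Valid M (A ⇒ B) → Valid M A → Valid M B
  mp-valid A⇒B A w = valid-⇒-elim A⇒B w (A w)

  mon□-valid : ∀ {A B} → Valid M (A ⇒ B) → Valid M (□ A ⇒ □ B)
  mon□-valid A⇒B _ _ _ □A v u≤v with □A v u≤v
  ... | α , Nα , αA = α , Nα , λ x αx → valid-⇒-elim A⇒B x (αA x αx)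

  mon◇-valid : ∀ {A B} → Valid M (A ⇒ B) → Valid M (◇ A ⇒ ◇ B)
  mon◇-valid A⇒B _ _ _ ◇A v u≤v α Nα with ◇A v u≤v α Nα
  ... | x , αx , xA = x , αx , valid-⇒-elim A⇒B x xA

  N□-valid : CondN M → Valid M (□ ⊤′)
  N□-valid condN _ v _ with condN v
  ... | α , Nα = α , Nα , λ _ _ _ _ ⊥-forced → ⊥-forced

  P◇-valid : CondP M → Valid M (◇ ⊤′)
  P◇-valid condP _ v _ α Nα with condP v α Nα
  ... | x , αx = x , αx , λ _ _ ⊥-forced → ⊥-forced

  C□-valid : ∀ {A B} → CondC M → Valid M (□ A ∧′ □ B ⇒ □ (A ∧′ B))
  C□-valid condC _ _ _ (□A , □B) v u≤v with □A v u≤v | □B v u≤v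
  ... | α , Nα , αA | β , Nβ , βB =
    (λ x → α x × β x) , condC v α β Nα Nβ , λ x (αx , βx) → αA x αx , βB x βx

  K◇-valid : ∀ {A B} → CondC M → Valid M (□ (A ⇒ B) ⇒ (◇ A ⇒ ◇ B))
  K◇-valid condC _ _ _ □A⇒B u′ u≤u′ ◇A v u′≤v α Nα
    with □A⇒B v (trans≤ u≤u′ u′≤v)
  ... | β , Nβ , βA⇒B with ◇A v u′≤v (λ x → α x × β x) (condC v α β Nα Nβ)
  ... | x , (αx , βx) , xA = x , αx , βA⇒B x βx x refl≤ xA

  D-valid : ∀ {A} → CondD M → Valid M (□ A ⇒ ◇ A)
  D-valid condD _ _ _ □A v u≤v α Nα with □A v u≤v
  ... | β , Nβ , βA with condD v α β Nα Nβ
  ... | x , αx , βx = x , αx , βA x βx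

  T□-valid : ∀ {A} → CondT M → Valid M (□ A ⇒ A)
  T□-valid condT _ u _ □A with □A u refl≤
  ... | α , Nα , αA = αA u (condT u α Nα)

  T◇-valid : ∀ {A} → CondT M → Valid M (A ⇒ ◇ A)
  T◇-valid {A} condT _ _ _ uA v u≤v α Nα = v , condT v α Nα , ⊩-mono A u≤v uA

  CondD⇒CondP : CondD M → CondP M
  CondD⇒CondP condD w α Nα with condD w α α Nα Nα
  ... | x , αx , _ = x , αx

  ModelFor⇒CondN : ∀ L → hasN□ L → ModelFor L M → CondN M
  ModelFor⇒CondN MMN  _ c = c
  ModelFor⇒CondN MMNP _ c = proj₁ c
  ModelFor⇒CondN MK   _ c = proj₂ c
  ModelFor⇒CondN MMND _ c = proj₁ c
  ModelFor⇒CondN MMNT _ c = proj₁ c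
  ModelFor⇒CondN MKD  _ c = proj₁ (proj₂ c)
  ModelFor⇒CondN MKT  _ c = proj₁ (proj₂ c)

  ModelFor⇒CondP : ∀ L → hasP◇ L → ModelFor L M → CondP M
  ModelFor⇒CondP MMP  _ c = c
  ModelFor⇒CondP MMNP _ c = proj₂ c
  ModelFor⇒CondP MMD  _ c = CondD⇒CondP c
  ModelFor⇒CondP MMCD _ c = CondD⇒CondP (proj₂ c)

  ModelFor⇒CondC : ∀ L → hasC L → ModelFor L M → CondC M
  ModelFor⇒CondC MMC  _ c = c
  ModelFor⇒CondC MK   _ c = proj₁ c
  ModelFor⇒CondC MMCD _ c = proj₁ c
  ModelFor⇒CondC MMCT _ c = proj₁ c
  ModelFor⇒CondC MKD  _ c = proj₁ c
  ModelFor⇒CondC MKT  _ c = proj₁ c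

  ModelFor⇒CondD : ∀ L → hasD L → ModelFor L M → CondD M
  ModelFor⇒CondD MMD  _ c = c
  ModelFor⇒CondD MMND _ c = proj₂ c
  ModelFor⇒CondD MMCD _ c = proj₂ c
  ModelFor⇒CondD MKD  _ c = proj₂ (proj₂ c)

  ModelFor⇒CondT : ∀ L → hasT L → ModelFor L M → CondT M
  ModelFor⇒CondT MMT  _ c = c
  ModelFor⇒CondT MMNT _ c = proj₂ c
  ModelFor⇒CondT MMCT _ c = proj₂ c
  ModelFor⇒CondT MKT  _ c = proj₂ (proj₂ c)

  sound : ∀ {L A} → ModelFor L M → L ⊢ A → Valid M A
  sound _ ax∧₁ _ _ _ (a , _) = a
  sound _ ax∧₂ _ _ _ (_ , b) = b
  sound _ ax∨₁ _ _ _ a = inj₁ a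
  sound _ ax∨₂ _ _ _ b = inj₂ b
  sound _ ax∧I _ _ _ f _ u≤u′ g x u′≤x a = f x (trans≤ u≤u′ u′≤x) a , g x u′≤x a
  sound _ ax∨E _ _ _ f _ u≤u′ g x u′≤x (inj₁ a) = f x (trans≤ u≤u′ u′≤x) a
  sound _ ax∨E _ _ _ _ _ _ g x u′≤x (inj₂ b) = g x u′≤x b
  sound _ axS  _ _ _ f _ u≤u′ g x u′≤x a =
    f x (trans≤ u≤u′ u′≤x) a x refl≤ (g x u′≤x a)
  sound _ (axK {A}) _ _ _ a _ u≤u′ _ = ⊩-mono A u≤u′ a
  sound c (mp d e)   = mp-valid (sound c d) (sound c e)
  sound c (mon□ d)   = mon□-valid (sound c d)
  sound c (mon◇ d)   = mon◇-valid (sound c d)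
  sound {L} c (axN□ h) = N□-valid (ModelFor⇒CondN L h c)
  sound {L} c (axP◇ h) = P◇-valid (ModelFor⇒CondP L h c)
  sound {L} c (axC□ h) = C□-valid (ModelFor⇒CondC L h c)
  sound {L} c (axK◇ h) = K◇-valid (ModelFor⇒CondC L h c)
  sound {L} c (axD h)  = D-valid (ModelFor⇒CondD L h c)
  sound {L} c (axT□ h) = T□-valid (ModelFor⇒CondT L h c)
  sound {L} c (axT◇ h) = T◇-valid (ModelFor⇒CondT L h c)

mainTheorem13 : (L : Logic) (A : Fm) → L ⊢ A → (M : Model) → ModelFor L M → Valid M A
mainTheorem13 L A d M c = Soundness.sound M c d
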